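{- Let $K$ be an imaginary quadratic field with discriminant $D_K$, let $\ell$ be a prime, and let $\mathcal O_0$ be an order in $K$ of conductor $c_0$ coprime to $\ell$, with discriminant $D_0=c_0^2D_K$. If $\ell\mathcal O_0=\mathcal L^2$ with $\mathcal L$ a principal prime ideal of $\mathcal O_0$, then $|D_0|\le 4\ell$; more precisely $$(D_K,c_0)\in\begin{cases}\{(-4\ell,1)\} & \text{if } \ell\equiv1\bmod4,\\ \{(-\ell,1),(-\ell,2)\} & \text{if } \ell\equiv 3\bmod 4,\\ \{(-8,1),(-4,1)\} & \text{if } \ell=2.\end{cases}$$ -}

module Defs where

open import Data.Nat as ℕ using (ℕ)
open import Data.Integer using (ℤ; +_; -_; _+_; _-_; _*_; ∣_∣; _/ℕ_; _%ℕ_)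
open import Data.Product using (_×_; _,_; ∃; Σ)
open import Data.Sum using (_⊎_)
open import Relation.Binary.PropositionalEquality using (_≡_)
open import Relation.Nullary using (¬_)
open import Data.Nat.Divisibility using (_∣_)

-- Squarefree integer: the only natural n with n² ∣ |m| is n = 1 (so 0 is not squarefree).
SquarefreeZ : ℤ → Set
SquarefreeZ m = ∀ (n : ℕ) → (n ℕ.* n) ∣ ∣ m ∣ → n ≡ 1

IsFundamentalDiscriminant : ℤ → Set
IsFundamentalDiscriminant D =
  ¬ (D ≡ + 1) ×
  ((D %ℕ 4 ≡ 1 × SquarefreeZ D) ⊎
   ∃ λ m → D ≡ + 4 * m × (m %ℕ 4 ≡ 2 ⊎ m %ℕ 4 ≡ 3) × SquarefreeZ m)

IsImagQuadDisc : ℤ → Set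
IsImagQuadDisc D = (D Data.Integer.< + 0) × IsFundamentalDiscriminant D

-- The order O of discriminant D (D ≡ 0,1 mod 4, D < 0):
-- O = ℤ[ω], ω = (D + √D)/2, ω² = D ω - (D² - D)/4.
-- An element a + bω is represented by the pair (a , b).

Elem : Set
Elem = ℤ × ℤ

ωconst : ℤ → ℤ
ωconst D = (D * D - D) /ℕ 4

mulO : ℤ → Elem → Elem → Elem
mulO D (a , b) (c , d) =
  (a * c - b * d * ωconst D , a * d + b * c + b * d * D)

addO : Elem → Elem → Elem
addO (a , b) (c , d) = (a + c , b + d)

zeroO : Elem
zeroO = (+ 0 , + 0)

oneO : Elem
oneO = (+ 1 , + 0)

PredO : Set₁
PredO = Elem → Set

record IsIdeal (D : ℤ) (I : PredO) : Set where
  field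
    has-zero : I zeroO
    +-closed : ∀ {x y} → I x → I y → I (addO x y)
    *-closed : ∀ r {x} → I x → I (mulO D r x)

Principal : ℤ → Elem → PredO
Principal D α x = ∃ λ r → x ≡ mulO D α r

data Prod (D : ℤ) (I J : PredO) : PredO where
  gen  : ∀ {x y} → I x → J y → Prod D I J (mulO D x y)
  zer  : Prod D I J zeroO
  add  : ∀ {x y} → Prod D I J x → Prod D I J y → Prod D I J (addO x y)
  smul : ∀ r {x} → Prod D I J x → Prod D I J (mulO D r x)

_≐_ : PredO → PredO → Set
I ≐ J = ∀ x → (I x → J x) × (J x → I x)

record IsPrimeIdeal (D : ℤ) (P : PredO) : Set where
  field
    ideal  : IsIdeal D P
    proper : ¬ P oneO
    prime  : ∀ x y → P (mulO D x y) → P x ⊎ P y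

IsPrincipal : ℤ → PredO → Set
IsPrincipal D I = ∃ λ α → I ≐ Principal D α

module Submission where

open import Defs
open import Data.Nat as ℕ using (ℕ; NonZero; suc; _≤_; _<_; s≤s; z≤n)
open import Data.Nat.Primality using (Prime)
open import Data.Nat.Coprimality using (Coprime)
open import Data.Nat.DivMod using (_%_)
open import Data.Integer as ℤ using (ℤ; +_; -_; ∣_∣)
open import Data.Product using (_×_; _,_; ∃)
open import Data.Sum using (_⊎_)
open import Relation.Binary.PropositionalEquality using (_≡_)

open import Data.Integer using (-[1+_])
import Data.Integer.Properties as ℤP
open import Data.Integer.Tactic.RingSolver using (solve)
open import Data.List using ([]; _∷_)
import Data.Nat.Properties as ℕP
open import Algebra.Properties.CommutativeSemigroup ℕP.*-commutativeSemigroup using (xy∙z≈xz∙y)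
open import Data.Nat.Divisibility
  using (_∣_; divides; ∣-antisym; ∣-trans; ∣-refl; ∣⇒≤; 1∣_; ∣1⇒≡1; m∣m*n; n∣m*n; m%n≡0⇒n∣m)
open import Data.Nat.DivMod using (_/_; m*[n/m]≡n; m%n<n; m%n≤m; m*n%n≡0; %-distribˡ-+; %-distribˡ-*)
open import Data.Nat.Primality
  using (¬prime[0]; ¬prime[1]; prime[2]; prime⇒nonZero; prime⇒nonTrivial; prime⇒irreducible;
         prime⇒¬composite; composite-≢; euclidsLemma)
import Data.Nat.Tactic.RingSolver as ℕ-Solver
open import Data.Product using (∃₂; proj₁; proj₂; map₁; map₂)
open import Data.Sum using (inj₁; inj₂; reduce)
open import Function using (_∘_)
open import Relation.Binary.Definitions using (tri<; tri≈; tri>)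
open import Relation.Binary.PropositionalEquality using (_≢_; refl; sym; trans; cong; cong₂; subst; module ≡-Reasoning)
open import Relation.Nullary using (¬_; contradiction)

-- Write D₀ = -d and L = αO with α = a + bω. Comparing norms in ℓO = α²O gives N(α) = ℓ,
-- that is 4ℓ = T² + d B² with T = |2a + bD₀| and B = |b|, where B ≠ 0 because ℓ is not a
-- square; and α² ∈ ℓO gives ℓ ∣ B T. As d ≥ 3, ℓ cannot divide B, so ℓ ∣ T, which leaves
-- T = 0 or T = ℓ ≤ 3. Since d B² = |D_K| (c₀ B)², the case T = 0 gives (|D_K|, c₀ B) = (4ℓ, 1)
-- or (ℓ, 2), and T = ℓ gives (4, 1) for ℓ = 2 and (3, 1) for ℓ = 3. The residues of
-- fundamental discriminants modulo 4 then decide which case occurs for each residue of ℓ.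

-- ℤ[ω] with ω² = D ω - w; mulO D is _·_ at w = ωconst D. Keeping w a variable lets the ring
-- solver treat it as an atom; as the solver only unfolds the head of a goal, identities
-- involving nested products are stated componentwise.
module QuadraticArithmetic (D w : ℤ) where
  open import Data.Integer using (_+_; _-_; _*_)

  infixl 7 _·_
  _·_ : Elem → Elem → Elem
  (a , b) · (c , d) = (a * c - b * d * w , a * d + b * c + b * d * D)

  norm : Elem → ℤ
  norm (a , b) = a * a + a * b * D + b * b * w

  ·-comm : ∀ x y → x · y ≡ y · x
  ·-comm (a , b) (c , d) =
    cong₂ _,_ (solve (a ∷ b ∷ c ∷ d ∷ w ∷ [])) (solve (a ∷ b ∷ c ∷ d ∷ D ∷ []))

  ·-assoc : ∀ x y z → (x · y) · z ≡ x · (y · z)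
  ·-assoc (a , b) (c , d) (e , f) = cong₂ _,_ assoc₁ assoc₂
    where
    assoc₁ : (a * c - b * d * w) * e - (a * d + b * c + b * d * D) * f * w
           ≡ a * (c * e - d * f * w) - b * (c * f + d * e + d * f * D) * w
    assoc₁ = solve (a ∷ b ∷ c ∷ d ∷ e ∷ f ∷ w ∷ D ∷ [])
    assoc₂ : (a * c - b * d * w) * f + (a * d + b * c + b * d * D) * e
               + (a * d + b * c + b * d * D) * f * D
           ≡ a * (c * f + d * e + d * f * D) + b * (c * e - d * f * w)
               + b * (c * f + d * e + d * f * D) * D
    assoc₂ = solve (a ∷ b ∷ c ∷ d ∷ e ∷ f ∷ w ∷ D ∷ [])

  x·yz≡y·xz : ∀ x y z → x · (y · z) ≡ y · (x · z)
  x·yz≡y·xz x y z = begin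
    x · (y · z) ≡⟨ ·-assoc x y z ⟨
    (x · y) · z ≡⟨ cong (_· z) (·-comm x y) ⟩
    (y · x) · z ≡⟨ ·-assoc y x z ⟩
    y · (x · z) ∎
    where open ≡-Reasoning

  ·-identityʳ : ∀ x → x · oneO ≡ x
  ·-identityʳ (a , b) =
    cong₂ _,_ (solve (a ∷ b ∷ w ∷ [])) (solve (a ∷ b ∷ D ∷ []))

  ·-zeroʳ : ∀ x → x · zeroO ≡ zeroO
  ·-zeroʳ (a , b) =
    cong₂ _,_ (solve (a ∷ b ∷ w ∷ [])) (solve (a ∷ b ∷ D ∷ []))

  ·-distribˡ-addO : ∀ x y z → x · addO y z ≡ addO (x · y) (x · z)
  ·-distribˡ-addO (a , b) (c , d) (e , f) = cong₂ _,_ distrib₁ distrib₂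
    where
    distrib₁ : a * (c + e) - b * (d + f) * w ≡ a * c - b * d * w + (a * e - b * f * w)
    distrib₁ = solve (a ∷ b ∷ c ∷ d ∷ e ∷ f ∷ w ∷ [])
    distrib₂ : a * (d + f) + b * (c + e) + b * (d + f) * D
             ≡ a * d + b * c + b * d * D + (a * f + b * e + b * f * D)
    distrib₂ = solve (a ∷ b ∷ c ∷ d ∷ e ∷ f ∷ D ∷ [])

  norm-· : ∀ x y → norm (x · y) ≡ norm x * norm y
  norm-· (a , b) (c , d) = multiplicative
    where
    multiplicative : (a * c - b * d * w) * (a * c - b * d * w)
                       + (a * c - b * d * w) * (a * d + b * c + b * d * D) * D
                       + (a * d + b * c + b * d * D) * (a * d + b * c + b * d * D) * w
                   ≡ (a * a + a * b * D + b * b * w) * (c * c + c * d * D + d * d * w)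
    multiplicative = solve (a ∷ b ∷ c ∷ d ∷ w ∷ D ∷ [])

  proj₂-scalar· : ∀ p y → proj₂ ((p , + 0) · y) ≡ p * proj₂ y
  proj₂-scalar· p (c , d) = scalar
    where
    scalar : p * d + + 0 * c + + 0 * d * D ≡ p * d
    scalar = solve (p ∷ c ∷ d ∷ D ∷ [])

  norm-scalar : ∀ p → norm (p , + 0) ≡ p * p
  norm-scalar p = scalar
    where
    scalar : p * p + p * + 0 * D + + 0 * + 0 * w ≡ p * p
    scalar = solve (p ∷ w ∷ D ∷ [])

  proj₂-square : ∀ a b → proj₂ ((a , b) · (a , b)) ≡ b * (+ 2 * a + b * D)
  proj₂-square a b = square
    where
    square : a * b + b * a + b * b * D ≡ b * (+ 2 * a + b * D)
    square = solve (a ∷ b ∷ D ∷ [])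

  four-norm : + 4 * w ≡ D * D - D → ∀ a b →
              + 4 * norm (a , b) ≡ (+ 2 * a + b * D) * (+ 2 * a + b * D) - D * (b * b)
  four-norm exact a b = begin
    + 4 * (a * a + a * b * D + b * b * w)
      ≡⟨ solve (a ∷ b ∷ w ∷ D ∷ []) ⟩
    + 4 * (a * a) + + 4 * (a * b * D) + b * b * (+ 4 * w)
      ≡⟨ cong (λ u → + 4 * (a * a) + + 4 * (a * b * D) + b * b * u) exact ⟩
    + 4 * (a * a) + + 4 * (a * b * D) + b * b * (D * D - D)
      ≡⟨ solve (a ∷ b ∷ D ∷ []) ⟩
    (+ 2 * a + b * D) * (+ 2 * a + b * D) - D * (b * b) ∎
    where open ≡-Reasoning

-- Principal ideals and norms

≐-trans : ∀ {I J K} → I ≐ J → J ≐ K → I ≐ K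
≐-trans I≐J J≐K x = proj₁ (J≐K x) ∘ proj₁ (I≐J x) , proj₂ (I≐J x) ∘ proj₂ (J≐K x)

module _ (D : ℤ) where
  open QuadraticArithmetic D (ωconst D)
  open import Data.Integer using (_*_)

  Principal-self : ∀ α → Principal D α α
  Principal-self α = oneO , sym (·-identityʳ α)

  Prod-mono : ∀ {I I′ J J′ : PredO} → (∀ {x} → I x → I′ x) → (∀ {x} → J x → J′ x) →
              ∀ {x} → Prod D I J x → Prod D I′ J′ x
  Prod-mono f g (gen Ix Jy) = gen (f Ix) (g Jy)
  Prod-mono f g zer         = zer
  Prod-mono f g (add p q)   = add (Prod-mono f g p) (Prod-mono f g q)
  Prod-mono f g (smul r p)  = smul r (Prod-mono f g p)

  Prod-cong : ∀ {I I′ J J′} → I ≐ I′ → J ≐ J′ → Prod D I J ≐ Prod D I′ J′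
  Prod-cong I≐I′ J≐J′ x =
    Prod-mono (proj₁ (I≐I′ _)) (proj₁ (J≐J′ _)) , Prod-mono (proj₂ (I≐I′ _)) (proj₂ (J≐J′ _))

  Prod-Principal : ∀ α β {x} → Prod D (Principal D α) (Principal D β) x → Principal D (α · β) x
  Prod-Principal α β (gen (r , refl) (s , refl)) = r · s , (begin
    (α · r) · (β · s) ≡⟨ ·-assoc α r (β · s) ⟩
    α · (r · (β · s)) ≡⟨ cong (α ·_) (x·yz≡y·xz r β s) ⟩
    α · (β · (r · s)) ≡⟨ ·-assoc α β (r · s) ⟨
    (α · β) · (r · s) ∎)
    where open ≡-Reasoning
  Prod-Principal α β zer = zeroO , sym (·-zeroʳ (α · β))
  Prod-Principal α β (add p q) with Prod-Principal α β p | Prod-Principal α β q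
  ... | r , refl | s , refl = addO r s , sym (·-distribˡ-addO (α · β) r s)
  Prod-Principal α β (smul t p) with Prod-Principal α β p
  ... | r , refl = t · r , x·yz≡y·xz t (α · β) r

  ∣norm∣-∣ : ∀ α {x} → Principal D α x → ∣ norm α ∣ ∣ ∣ norm x ∣
  ∣norm∣-∣ α (r , refl) =
    subst (∣ norm α ∣ ∣_) (sym (trans (cong ∣_∣ (norm-· α r)) (ℤP.abs-* (norm α) (norm r))))
          (m∣m*n ∣ norm r ∣)

  associated⇒∣norm∣≡ : ∀ α β → Principal D α β → Principal D β α → ∣ norm α ∣ ≡ ∣ norm β ∣
  associated⇒∣norm∣≡ α β β∈αO α∈βO = ∣-antisym (∣norm∣-∣ α β∈αO) (∣norm∣-∣ β α∈βO)

  Principal-ℕ⇒∣proj₂ : ∀ {n x} → Principal D (+ n , + 0) x → n ∣ ∣ proj₂ x ∣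
  Principal-ℕ⇒∣proj₂ {n} (y , refl) = divides ∣ proj₂ y ∣ (begin
    ∣ proj₂ ((+ n , + 0) · y) ∣ ≡⟨ cong ∣_∣ (proj₂-scalar· (+ n) y) ⟩
    ∣ + n * proj₂ y ∣           ≡⟨ ℤP.abs-* (+ n) (proj₂ y) ⟩
    n ℕ.* ∣ proj₂ y ∣           ≡⟨ ℕP.*-comm n ∣ proj₂ y ∣ ⟩
    ∣ proj₂ y ∣ ℕ.* n           ∎)
    where open ≡-Reasoning

m*m≡n*n⇒m≡n : ∀ {m n} → m ℕ.* m ≡ n ℕ.* n → m ≡ n
m*m≡n*n⇒m≡n {m} {n} eq with ℕP.<-cmp m n
... | tri< m<n _ _ = contradiction eq (ℕP.<⇒≢ (ℕP.*-mono-< m<n m<n))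
... | tri≈ _ m≡n _ = m≡n
... | tri> _ _ m>n = contradiction eq (ℕP.>⇒≢ (ℕP.*-mono-< m>n m>n))

prime⇒¬square : ∀ {p} → Prime p → ∀ m → m ℕ.* m ≢ p
prime⇒¬square p-prime 0 refl = ¬prime[0] p-prime
prime⇒¬square p-prime 1 refl = ¬prime[1] p-prime
prime⇒¬square p-prime m@(suc (suc _)) refl =
  prime⇒¬composite p-prime (composite-≢ m m≢m*m (divides m refl))
  where
  m≢m*m : m ≢ m ℕ.* m
  m≢m*m = ℕP.<⇒≢ (ℕP.m<m*n m m (s≤s (s≤s z≤n)))

i*i≡+∣i∣*∣i∣ : ∀ i → i ℤ.* i ≡ + (∣ i ∣ ℕ.* ∣ i ∣)
i*i≡+∣i∣*∣i∣ (+ n)    = sym (ℤP.pos-* n n)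
i*i≡+∣i∣*∣i∣ -[1+ n ] = refl

-- The norm equation of a principal square root of ℓO

NormEquation : ℕ → ℕ → Set
NormEquation ℓ d = ∃₂ λ T B → 1 ≤ B × 4 ℕ.* ℓ ≡ T ℕ.* T ℕ.+ d ℕ.* (B ℕ.* B) × ℓ ∣ B ℕ.* T

module _ (d : ℕ) (4∣d[1+d] : 4 ∣ d ℕ.* suc d) where
  open QuadraticArithmetic (- + d) (ωconst (- + d))
  open import Data.Integer using (_+_; _-_; _*_)

  -- ωconst D floors (D² - D) / 4; it is the constant term of ω² only when 4 ∣ D² - D.
  ωconst-exact : + 4 * ωconst (- + d) ≡ (- + d) * (- + d) - (- + d)
  ωconst-exact = begin
    + 4 * ωconst (- + d)          ≡⟨ cong (λ z → + 4 * (z ℤ./ℕ 4)) D²-D≡d[1+d] ⟩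
    + 4 * + (d ℕ.* suc d / 4)     ≡⟨ ℤP.pos-* 4 (d ℕ.* suc d / 4) ⟨
    + (4 ℕ.* (d ℕ.* suc d / 4))   ≡⟨ cong +_ (m*[n/m]≡n 4∣d[1+d]) ⟩
    + (d ℕ.* suc d)               ≡⟨ D²-D≡d[1+d] ⟨
    (- + d) * (- + d) - (- + d)   ∎
    where
    open ≡-Reasoning
    D²-D≡d[1+d] : (- + d) * (- + d) - (- + d) ≡ + (d ℕ.* suc d)
    D²-D≡d[1+d] = trans ([-x]*[-x]-[-x]≡x*[1+x] (+ d)) (sym (ℤP.pos-* d (suc d)))
      where
      [-x]*[-x]-[-x]≡x*[1+x] : ∀ x → (- x) * (- x) - (- x) ≡ x * (+ 1 + x)
      [-x]*[-x]-[-x]≡x*[1+x] x = solve (x ∷ [])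

  four-∣norm∣ : ∀ a b → let t = + 2 * a + b * - + d in
                4 ℕ.* ∣ norm (a , b) ∣ ≡ ∣ t ∣ ℕ.* ∣ t ∣ ℕ.+ d ℕ.* (∣ b ∣ ℕ.* ∣ b ∣)
  four-∣norm∣ a b = begin
    4 ℕ.* ∣ norm (a , b) ∣         ≡⟨ ℤP.abs-* (+ 4) (norm (a , b)) ⟨
    ∣ + 4 * norm (a , b) ∣         ≡⟨ cong ∣_∣ (four-norm ωconst-exact a b) ⟩
    ∣ t * t - - + d * (b * b) ∣    ≡⟨ cong ∣_∣ (x-[-y]*z≡x+y*z (t * t) (+ d) (b * b)) ⟩
    ∣ t * t + + d * (b * b) ∣      ≡⟨ cong₂ (λ u v → ∣ u + + d * v ∣) (i*i≡+∣i∣*∣i∣ t) (i*i≡+∣i∣*∣i∣ b) ⟩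
    ∣ + (∣ t ∣ ℕ.* ∣ t ∣) + + d * + (∣ b ∣ ℕ.* ∣ b ∣) ∣
      ≡⟨ cong (λ u → ∣ + (∣ t ∣ ℕ.* ∣ t ∣) + u ∣) (ℤP.pos-* d (∣ b ∣ ℕ.* ∣ b ∣)) ⟨
    ∣ t ∣ ℕ.* ∣ t ∣ ℕ.+ d ℕ.* (∣ b ∣ ℕ.* ∣ b ∣) ∎
    where
    open ≡-Reasoning
    t = + 2 * a + b * - + d
    x-[-y]*z≡x+y*z : ∀ x y z → x - (- y) * z ≡ x + y * z
    x-[-y]*z≡x+y*z x y z = solve (x ∷ y ∷ z ∷ [])

  principal-root⇒NormEquation : ∀ {ℓ} → Prime ℓ → ∀ α →
    Principal (- + d) (+ ℓ , + 0) ≐ Prod (- + d) (Principal (- + d) α) (Principal (- + d) α) →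
    NormEquation ℓ d
  principal-root⇒NormEquation {ℓ} ℓ-prime α@(a , b) ℓO≐[αO]² =
    ∣ t ∣ , ∣ b ∣ , 1≤∣b∣ , trans (cong (4 ℕ.*_) (sym ∣Nα∣≡ℓ)) (four-∣norm∣ a b) , ℓ∣∣b∣∣t∣
    where
    open ≡-Reasoning
    D = - + d
    t = + 2 * a + b * D

    ℓ∈α²O : Principal D (α · α) (+ ℓ , + 0)
    ℓ∈α²O = Prod-Principal D α α (proj₁ (ℓO≐[αO]² _) (Principal-self D _))

    α²∈ℓO : Principal D (+ ℓ , + 0) (α · α)
    α²∈ℓO = proj₂ (ℓO≐[αO]² _) (gen (Principal-self D α) (Principal-self D α))

    ∣Nα∣≡ℓ : ∣ norm α ∣ ≡ ℓ
    ∣Nα∣≡ℓ = m*m≡n*n⇒m≡n (begin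
      ∣ norm α ∣ ℕ.* ∣ norm α ∣ ≡⟨ ℤP.abs-* (norm α) (norm α) ⟨
      ∣ norm α * norm α ∣       ≡⟨ cong ∣_∣ (norm-· α α) ⟨
      ∣ norm (α · α) ∣          ≡⟨ associated⇒∣norm∣≡ D (α · α) _ ℓ∈α²O α²∈ℓO ⟩
      ∣ norm (+ ℓ , + 0) ∣      ≡⟨ cong ∣_∣ (norm-scalar (+ ℓ)) ⟩
      ∣ + ℓ * + ℓ ∣             ≡⟨ ℤP.abs-* (+ ℓ) (+ ℓ) ⟩
      ℓ ℕ.* ℓ                   ∎)

    1≤∣b∣ : 1 ≤ ∣ b ∣
    1≤∣b∣ = ℕP.n≢0⇒n>0 λ ∣b∣≡0 → prime⇒¬square ℓ-prime ∣ a ∣ (begin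
      ∣ a ∣ ℕ.* ∣ a ∣      ≡⟨ ℤP.abs-* a a ⟨
      ∣ a * a ∣            ≡⟨ cong ∣_∣ (norm-scalar a) ⟨
      ∣ norm (a , + 0) ∣   ≡⟨ cong (λ z → ∣ norm (a , z) ∣) (ℤP.∣i∣≡0⇒i≡0 ∣b∣≡0) ⟨
      ∣ norm α ∣           ≡⟨ ∣Nα∣≡ℓ ⟩
      ℓ                    ∎)

    ℓ∣∣b∣∣t∣ : ℓ ∣ ∣ b ∣ ℕ.* ∣ t ∣
    ℓ∣∣b∣∣t∣ = subst (ℓ ∣_) (trans (cong ∣_∣ (proj₂-square a b)) (ℤP.abs-* b t))
                     (Principal-ℕ⇒∣proj₂ D α²∈ℓO)

-- Solving 4ℓ = T² + n m²

open import Data.Nat using (_+_; _*_; _∸_)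

4ℓ<3ℓ² : ∀ {ℓ} → 2 ≤ ℓ → 4 * ℓ < 3 * (ℓ * ℓ)
4ℓ<3ℓ² {ℓ@(suc _)} 2≤ℓ = begin-strict
  4 * ℓ       <⟨ ℕP.*-monoˡ-< ℓ {4} {6} (s≤s (s≤s (s≤s (s≤s (s≤s z≤n))))) ⟩
  6 * ℓ       ≡⟨ ℕP.*-assoc 3 2 ℓ ⟩
  3 * (2 * ℓ) ≤⟨ ℕP.*-monoʳ-≤ 3 (ℕP.*-monoˡ-≤ ℓ 2≤ℓ) ⟩
  3 * (ℓ * ℓ) ∎
  where open ℕP.≤-Reasoning

n*m²≤4ℓ⇒ℓ∤m : ∀ {ℓ n m} → Prime ℓ → 3 ≤ n → 1 ≤ m → n * (m * m) ≤ 4 * ℓ → ¬ ℓ ∣ m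
n*m²≤4ℓ⇒ℓ∤m {ℓ} {n} {m} ℓ-prime 3≤n 1≤m nm²≤4ℓ ℓ∣m =
  ℕP.<⇒≱ (4ℓ<3ℓ² (ℕ.nonTrivial⇒n>1 ℓ)) (begin
    3 * (ℓ * ℓ) ≤⟨ ℕP.*-mono-≤ 3≤n (ℕP.*-mono-≤ ℓ≤m ℓ≤m) ⟩
    n * (m * m) ≤⟨ nm²≤4ℓ ⟩
    4 * ℓ       ∎)
  where
  open ℕP.≤-Reasoning
  instance
    _ = prime⇒nonTrivial ℓ-prime
    _ = ℕ.>-nonZero 1≤m
  ℓ≤m = ∣⇒≤ ℓ∣m

0<n*m² : ∀ {n m} → 3 ≤ n → 1 ≤ m → 0 < n * (m * m)
0<n*m² 3≤n 1≤m = ℕP.*-mono-≤ (ℕP.≤-trans (s≤s z≤n) 3≤n) (ℕP.*-mono-≤ 1≤m 1≤m)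

ℓ∣T⇒T≡0⊎T≡ℓ : ∀ {ℓ T} → .{{NonZero ℓ}} → ℓ ∣ T → T * T < 4 * ℓ → T ≡ 0 ⊎ T ≡ ℓ
ℓ∣T⇒T≡0⊎T≡ℓ (divides 0 T≡0) _ = inj₁ T≡0
ℓ∣T⇒T≡0⊎T≡ℓ {ℓ} (divides 1 T≡ℓ) _ = inj₂ (trans T≡ℓ (ℕP.*-identityˡ ℓ))
ℓ∣T⇒T≡0⊎T≡ℓ {ℓ} {T} (divides (suc (suc q)) refl) T²<4ℓ = contradiction T²<4ℓ (ℕP.≤⇒≯ (begin
  4 * ℓ             ≤⟨ ℕP.*-monoʳ-≤ 4 (ℕP.m≤m*n ℓ ℓ) ⟩
  4 * (ℓ * ℓ)       ≡⟨ ℕ-Solver.solve (ℓ ∷ []) ⟩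
  (2 * ℓ) * (2 * ℓ) ≤⟨ ℕP.*-mono-≤ 2ℓ≤T 2ℓ≤T ⟩
  T * T             ∎))
  where
  open ℕP.≤-Reasoning
  2ℓ≤T : 2 * ℓ ≤ T
  2ℓ≤T = ℕP.*-monoˡ-≤ ℓ {2} {suc (suc q)} (s≤s (s≤s z≤n))

data Solution : ℕ → ℕ → ℕ → Set where
  n≡4ℓ    : ∀ {ℓ} → Solution ℓ (4 * ℓ) 1
  n≡ℓ     : ∀ {ℓ m} → m ∣ 2 → Solution ℓ ℓ m
  ℓ≡2∧n≡4 : Solution 2 4 1

i*m²≡4 : ∀ i m → i * (m * m) ≡ 4 → (i ≡ 4 × m ≡ 1) ⊎ (i ≡ 1 × m ≡ 2)
i*m²≡4 i 0 eq = contradiction (trans (sym (ℕP.*-zeroʳ i)) eq) λ ()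
i*m²≡4 i 1 eq = inj₁ (trans (sym (ℕP.*-identityʳ i)) eq , refl)
i*m²≡4 i 2 eq = inj₂ (ℕP.*-cancelʳ-≡ i 1 4 eq , refl)
i*m²≡4 0 (suc (suc (suc m))) ()
i*m²≡4 (suc i) m@(suc (suc (suc _))) eq = contradiction eq (ℕP.>⇒≢ (begin-strict
  4               <⟨ s≤s (s≤s (s≤s (s≤s (s≤s z≤n)))) ⟩
  3 * 3           ≤⟨ ℕP.*-mono-≤ 3≤m 3≤m ⟩
  m * m           ≤⟨ ℕP.m≤n*m (m * m) (suc i) ⟩
  suc i * (m * m) ∎))
  where
  open ℕP.≤-Reasoning
  3≤m : 3 ≤ m
  3≤m = s≤s (s≤s (s≤s z≤n))

n*m²<12⇒m≡1 : ∀ {n m k} → 3 ≤ n → 1 ≤ m → n * (m * m) ≡ k → k < 12 → m ≡ 1 × n ≡ k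
n*m²<12⇒m≡1 {n} {1} _ _ eq _ = refl , trans (sym (ℕP.*-identityʳ n)) eq
n*m²<12⇒m≡1 {n} {m@(suc (suc _))} 3≤n _ refl k<12 = contradiction k<12 (ℕP.≤⇒≯ (begin
  3 * (2 * 2) ≤⟨ ℕP.*-mono-≤ 3≤n (ℕP.*-mono-≤ 2≤m 2≤m) ⟩
  n * (m * m) ∎))
  where
  open ℕP.≤-Reasoning
  2≤m : 2 ≤ m
  2≤m = s≤s (s≤s z≤n)

nm²≡4ℓ⇒Solution : ∀ {ℓ n m} → Prime ℓ → 3 ≤ n → 1 ≤ m → n * (m * m) ≡ 4 * ℓ → Solution ℓ n m
nm²≡4ℓ⇒Solution {ℓ} {n} {m} ℓ-prime 3≤n 1≤m eq with euclidsLemma n (m * m) ℓ-prime (divides 4 eq)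
... | inj₂ ℓ∣m² = contradiction (reduce (euclidsLemma m m ℓ-prime ℓ∣m²))
                              (n*m²≤4ℓ⇒ℓ∤m ℓ-prime 3≤n 1≤m (ℕP.≤-reflexive eq))
... | inj₁ (divides i refl)
  with i*m²≡4 i m (ℕP.*-cancelʳ-≡ _ _ ℓ {{prime⇒nonZero ℓ-prime}} (trans (xy∙z≈xz∙y i (m * m) ℓ) eq))
...   | inj₁ (refl , refl) = n≡4ℓ
...   | inj₂ (refl , refl) = subst (λ n → Solution ℓ n 2) (sym (ℕP.*-identityˡ ℓ)) (n≡ℓ ∣-refl)

ℓ²+nm²≡4ℓ⇒Solution : ∀ {ℓ n m} → Prime ℓ → 3 ≤ n → 1 ≤ m →
                      ℓ * ℓ + n * (m * m) ≡ 4 * ℓ → Solution ℓ n m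
ℓ²+nm²≡4ℓ⇒Solution {0} ℓ-prime = contradiction ℓ-prime ¬prime[0]
ℓ²+nm²≡4ℓ⇒Solution {1} ℓ-prime = contradiction ℓ-prime ¬prime[1]
ℓ²+nm²≡4ℓ⇒Solution {2} {n} {m} _ 3≤n 1≤m eq
  with n*m²<12⇒m≡1 3≤n 1≤m (ℕP.+-cancelˡ-≡ 4 (n * (m * m)) 4 eq) (s≤s (s≤s (s≤s (s≤s (s≤s z≤n)))))
... | refl , refl = ℓ≡2∧n≡4
ℓ²+nm²≡4ℓ⇒Solution {3} {n} {m} _ 3≤n 1≤m eq
  with n*m²<12⇒m≡1 3≤n 1≤m (ℕP.+-cancelˡ-≡ 9 (n * (m * m)) 3 eq) (s≤s (s≤s (s≤s (s≤s z≤n))))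
... | refl , refl = n≡ℓ (1∣ 2)
ℓ²+nm²≡4ℓ⇒Solution {ℓ@(suc (suc (suc (suc _))))} {n} {m} _ 3≤n 1≤m eq =
  contradiction eq (ℕP.>⇒≢ (begin-strict
    4 * ℓ               ≤⟨ ℕP.*-monoˡ-≤ ℓ {4} {ℓ} (s≤s (s≤s (s≤s (s≤s z≤n)))) ⟩
    ℓ * ℓ               <⟨ ℕP.m<m+n (ℓ * ℓ) (0<n*m² 3≤n 1≤m) ⟩
    ℓ * ℓ + n * (m * m) ∎))
  where open ℕP.≤-Reasoning

4ℓ≡T²+nm²⇒Solution : ∀ {ℓ n m T} → Prime ℓ → 3 ≤ n → 1 ≤ m →
                      4 * ℓ ≡ T * T + n * (m * m) → ℓ ∣ m * T → Solution ℓ n m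
4ℓ≡T²+nm²⇒Solution {ℓ} {n} {m} {T} ℓ-prime 3≤n 1≤m eq ℓ∣mT with euclidsLemma m T ℓ-prime ℓ∣mT
... | inj₁ ℓ∣m =
  contradiction ℓ∣m (n*m²≤4ℓ⇒ℓ∤m ℓ-prime 3≤n 1≤m (subst (n * (m * m) ≤_) (sym eq) (ℕP.m≤n+m _ (T * T))))
... | inj₂ ℓ∣T with ℓ∣T⇒T≡0⊎T≡ℓ {{prime⇒nonZero ℓ-prime}} ℓ∣T
                      (subst (T * T <_) (sym eq) (ℕP.m<m+n (T * T) (0<n*m² 3≤n 1≤m)))
...   | inj₁ refl = nm²≡4ℓ⇒Solution ℓ-prime 3≤n 1≤m (sym eq)
...   | inj₂ refl = ℓ²+nm²≡4ℓ⇒Solution ℓ-prime 3≤n 1≤m (sym eq)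

-- Discriminants modulo 4

-- -n is the discriminant of an order.
NegDiscriminant : ℕ → Set
NegDiscriminant n = n % 4 ≡ 0 ⊎ n % 4 ≡ 3

-- The residue conditions for -n to be a fundamental discriminant.
NegFundamental : ℕ → Set
NegFundamental n = n % 4 ≡ 3 ⊎ ∃ λ j → n ≡ 4 * j × (j % 4 ≡ 1 ⊎ j % 4 ≡ 2)

-[1+n]%ℕ4≡r⇒[1+n]%4≡[4∸r]%4 : ∀ n {r} → -[1+ n ] ℤ.%ℕ 4 ≡ r → suc n % 4 ≡ (4 ∸ r) % 4
-[1+n]%ℕ4≡r⇒[1+n]%4≡[4∸r]%4 n refl with suc n % 4 | m%n<n (suc n) 4
... | 0 | _ = refl
... | 1 | _ = refl
... | 2 | _ = refl
... | 3 | _ = refl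
... | suc (suc (suc (suc _))) | s≤s (s≤s (s≤s (s≤s ())))

fundamental⇒NegFundamental : ∀ k → IsFundamentalDiscriminant -[1+ k ] → NegFundamental (suc k)
fundamental⇒NegFundamental k (_ , inj₁ (D%4≡1 , _)) = inj₁ (-[1+n]%ℕ4≡r⇒[1+n]%4≡[4∸r]%4 k D%4≡1)
fundamental⇒NegFundamental k (_ , inj₂ (+ 0 , _ , inj₁ () , _))
fundamental⇒NegFundamental k (_ , inj₂ (+ 0 , _ , inj₂ () , _))
fundamental⇒NegFundamental k (_ , inj₂ (+ suc j , () , _))
fundamental⇒NegFundamental k (_ , inj₂ (-[1+ j ] , D≡4m , m%4 , _)) =
  inj₂ (suc j , cong suc (ℤP.-[1+-injective D≡4m) , residue m%4)
  where
  residue : -[1+ j ] ℤ.%ℕ 4 ≡ 2 ⊎ -[1+ j ] ℤ.%ℕ 4 ≡ 3 → suc j % 4 ≡ 1 ⊎ suc j % 4 ≡ 2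
  residue (inj₁ m%4≡2) = inj₂ (-[1+n]%ℕ4≡r⇒[1+n]%4≡[4∸r]%4 j m%4≡2)
  residue (inj₂ m%4≡3) = inj₁ (-[1+n]%ℕ4≡r⇒[1+n]%4≡[4∸r]%4 j m%4≡3)

[4*j]%4≡0 : ∀ j → (4 * j) % 4 ≡ 0
[4*j]%4≡0 j = trans (cong (_% 4) (ℕP.*-comm 4 j)) (m*n%n≡0 j 4)

NegFundamental⇒NegDiscriminant : ∀ {n} → NegFundamental n → NegDiscriminant n
NegFundamental⇒NegDiscriminant (inj₁ n%4≡3)           = inj₂ n%4≡3
NegFundamental⇒NegDiscriminant (inj₂ (j , refl , _)) = inj₁ ([4*j]%4≡0 j)

NegFundamental⇒3≤ : ∀ {n} → NegFundamental n → 3 ≤ n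
NegFundamental⇒3≤ {n} (inj₁ n%4≡3)                = subst (_≤ n) n%4≡3 (m%n≤m n 4)
NegFundamental⇒3≤ (inj₂ (0 , refl , inj₁ ()))
NegFundamental⇒3≤ (inj₂ (0 , refl , inj₂ ()))
NegFundamental⇒3≤ (inj₂ (suc j , refl , _))        = ℕP.≤-trans (ℕP.n≤1+n 3) (ℕP.m≤m*n 4 (suc j))

NegFundamental[4ℓ]⇒ℓ%4≢3 : ∀ {ℓ} → NegFundamental (4 * ℓ) → ℓ % 4 ≢ 3
NegFundamental[4ℓ]⇒ℓ%4≢3 {ℓ} (inj₁ 4ℓ%4≡3) _ = contradiction (trans (sym ([4*j]%4≡0 ℓ)) 4ℓ%4≡3) λ ()
NegFundamental[4ℓ]⇒ℓ%4≢3 {ℓ} (inj₂ (j , 4ℓ≡4j , j%4)) ℓ%4≡3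
  with ℕP.*-cancelˡ-≡ ℓ j 4 4ℓ≡4j | j%4
... | refl | inj₁ j%4≡1 = contradiction (trans (sym ℓ%4≡3) j%4≡1) λ ()
... | refl | inj₂ j%4≡2 = contradiction (trans (sym ℓ%4≡3) j%4≡2) λ ()

[c*c]%4 : ∀ c → (c * c) % 4 ≡ 0 ⊎ (c * c) % 4 ≡ 1
[c*c]%4 c rewrite %-distribˡ-* c c 4 {{_}} with c % 4 | m%n<n c 4
... | 0 | _ = inj₁ refl
... | 1 | _ = inj₂ refl
... | 2 | _ = inj₁ refl
... | 3 | _ = inj₂ refl
... | suc (suc (suc (suc _))) | s≤s (s≤s (s≤s (s≤s ())))

NegDiscriminant-*-square : ∀ c {n} → NegDiscriminant n → NegDiscriminant (c * c * n)
NegDiscriminant-*-square c {n} n-disc rewrite %-distribˡ-* (c * c) n 4 {{_}} with [c*c]%4 c | n-disc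
... | inj₁ c²≡0 | _         rewrite c²≡0        = inj₁ refl
... | inj₂ c²≡1 | inj₁ n≡0 rewrite c²≡1 | n≡0 = inj₁ refl
... | inj₂ c²≡1 | inj₂ n≡3 rewrite c²≡1 | n≡3 = inj₂ refl

NegDiscriminant⇒4∣n*[1+n] : ∀ {n} → NegDiscriminant n → 4 ∣ n * suc n
NegDiscriminant⇒4∣n*[1+n] {n} (inj₁ n%4≡0) = ∣-trans (m%n≡0⇒n∣m n 4 n%4≡0) (m∣m*n (suc n))
NegDiscriminant⇒4∣n*[1+n] {n} (inj₂ n%4≡3) = ∣-trans (m%n≡0⇒n∣m (suc n) 4 [1+n]%4≡0) (n∣m*n n)
  where
  [1+n]%4≡0 : suc n % 4 ≡ 0
  [1+n]%4≡0 = trans (%-distribˡ-+ 1 n 4) (cong (λ r → (1 + r) % 4) n%4≡3)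

NegDiscriminant⇒%4≢1 : ∀ {n} → NegDiscriminant n → n % 4 ≢ 1
NegDiscriminant⇒%4≢1 (inj₁ n%4≡0) n%4≡1 = contradiction (trans (sym n%4≡0) n%4≡1) λ ()
NegDiscriminant⇒%4≢1 (inj₂ n%4≡3) n%4≡1 = contradiction (trans (sym n%4≡3) n%4≡1) λ ()

¬NegDiscriminant[2] : ¬ NegDiscriminant 2
¬NegDiscriminant[2] (inj₁ ())
¬NegDiscriminant[2] (inj₂ ())

Classification : ℤ → ℕ → ℕ → Set
Classification DK ℓ c =
  (ℓ % 4 ≡ 1 → DK ≡ - (+ (4 * ℓ)) × c ≡ 1)
  × (ℓ % 4 ≡ 3 → DK ≡ - (+ ℓ) × (c ≡ 1 ⊎ c ≡ 2))
  × (ℓ ≡ 2 → (DK ≡ - (+ 8) ⊎ DK ≡ - (+ 4)) × c ≡ 1)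

classify : ∀ {ℓ n m c} → NegFundamental n → Solution ℓ n m → c ∣ m → Classification (- (+ n)) ℓ c
classify {ℓ} fund n≡4ℓ c∣1 =
  (λ _ → refl , ∣1⇒≡1 c∣1) ,
  (λ ℓ%4≡3 → contradiction ℓ%4≡3 (NegFundamental[4ℓ]⇒ℓ%4≢3 {ℓ} fund)) ,
  λ { refl → inj₁ refl , ∣1⇒≡1 c∣1 }
classify {ℓ} fund (n≡ℓ m∣2) c∣m =
  (λ ℓ%4≡1 → contradiction ℓ%4≡1 (NegDiscriminant⇒%4≢1 {ℓ} disc)) ,
  (λ _ → refl , prime⇒irreducible prime[2] (∣-trans c∣m m∣2)) ,
  λ { refl → contradiction disc ¬NegDiscriminant[2] }
  where
  disc : NegDiscriminant ℓ
  disc = NegFundamental⇒NegDiscriminant {ℓ} fund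
classify _ ℓ≡2∧n≡4 c∣1 = (λ ()) , (λ ()) , λ _ → inj₂ refl , ∣1⇒≡1 c∣1

NormEquation⇒Solution : ∀ {ℓ c n} → Prime ℓ → .{{NonZero c}} → NegFundamental n →
  NormEquation ℓ (c * c * n) → c * c * n ≤ 4 * ℓ × ∃ λ m → c ∣ m × Solution ℓ n m
NormEquation⇒Solution {ℓ} {c} {n} ℓ-prime fund (T , B , 1≤B , 4ℓ≡T²+dB² , ℓ∣BT) =
  d≤4ℓ , c * B , m∣m*n B ,
  4ℓ≡T²+nm²⇒Solution ℓ-prime (NegFundamental⇒3≤ {n} fund) 1≤cB 4ℓ≡T²+n[cB]² ℓ∣cBT
  where
  d = c * c * n

  1≤cB : 1 ≤ c * B
  1≤cB = ℕP.*-mono-≤ (ℕ.>-nonZero⁻¹ c) 1≤B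

  4ℓ≡T²+n[cB]² : 4 * ℓ ≡ T * T + n * (c * B * (c * B))
  4ℓ≡T²+n[cB]² = trans 4ℓ≡T²+dB² (cong (_+_ (T * T)) (ℕ-Solver.solve (c ∷ n ∷ B ∷ [])))

  ℓ∣cBT : ℓ ∣ c * B * T
  ℓ∣cBT = subst (ℓ ∣_) (sym (ℕP.*-assoc c B T)) (∣-trans ℓ∣BT (n∣m*n c))

  d≤4ℓ : d ≤ 4 * ℓ
  d≤4ℓ = begin
    d                   ≤⟨ ℕP.m≤m*n d (B * B) {{ℕ.>-nonZero (ℕP.*-mono-≤ 1≤B 1≤B)}} ⟩
    d * (B * B)         ≤⟨ ℕP.m≤n+m (d * (B * B)) (T * T) ⟩
    T * T + d * (B * B) ≡⟨ 4ℓ≡T²+dB² ⟨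
    4 * ℓ               ∎
    where open ℕP.≤-Reasoning

ramified-principal⇒Solution : ∀ {ℓ c n D} α → Prime ℓ → .{{NonZero c}} → NegFundamental n →
  D ≡ - (+ (c * c * n)) → Principal D (+ ℓ , + 0) ≐ Prod D (Principal D α) (Principal D α) →
  ∣ D ∣ ≤ 4 * ℓ × ∃ λ m → c ∣ m × Solution ℓ n m
ramified-principal⇒Solution {ℓ} {c} {n} α ℓ-prime fund refl ℓO≐[αO]² =
  map₁ (subst (_≤ 4 * ℓ) (sym (ℤP.∣-i∣≡∣i∣ (+ d))))
       (NormEquation⇒Solution ℓ-prime fund (principal-root⇒NormEquation d 4∣d[1+d] ℓ-prime α ℓO≐[αO]²))
  where
  d = c * c * n
  4∣d[1+d] : 4 ∣ d * suc d
  4∣d[1+d] = NegDiscriminant⇒4∣n*[1+n] {d}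
               (NegDiscriminant-*-square c {n} (NegFundamental⇒NegDiscriminant {n} fund))

proposition2p3 : (DK : ℤ) (ℓ c₀ : ℕ) → IsImagQuadDisc DK → Prime ℓ → NonZero c₀ → Coprime c₀ ℓ →
    let D₀ = (+ (c₀ ℕ.* c₀)) ℤ.* DK in
    (∃ λ (L : PredO) → IsPrimeIdeal D₀ L × IsPrincipal D₀ L × (Principal D₀ (+ ℓ , + 0) ≐ Prod D₀ L L)) →
    (∣ D₀ ∣ ℕ.≤ 4 ℕ.* ℓ)
    × (ℓ % 4 ≡ 1 → DK ≡ - (+ (4 ℕ.* ℓ)) × c₀ ≡ 1)
    × (ℓ % 4 ≡ 3 → DK ≡ - (+ ℓ) × (c₀ ≡ 1 ⊎ c₀ ≡ 2))
    × (ℓ ≡ 2 → (DK ≡ - (+ 8) ⊎ DK ≡ - (+ 4)) × c₀ ≡ 1)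
proposition2p3 (+ _) _ _ (ℤ.+<+ () , _) _ _ _ _
proposition2p3 -[1+ k ] ℓ c₀ (_ , DK-fundamental) ℓ-prime c₀≢0 _ (L , _ , (α , L≐αO) , ℓO≐L²) =
  map₂ (λ { (_ , c₀∣m , solution) → classify fund solution c₀∣m })
       (ramified-principal⇒Solution {n = suc k} α ℓ-prime {{c₀≢0}} fund D₀≡-d
          (≐-trans ℓO≐L² (Prod-cong _ L≐αO L≐αO)))
  where
  fund = fundamental⇒NegFundamental k DK-fundamental

  D₀≡-d : + (c₀ * c₀) ℤ.* -[1+ k ] ≡ - (+ (c₀ * c₀ * suc k))
  D₀≡-d = trans (sym (ℤP.neg-distribʳ-* (+ (c₀ * c₀)) (+ suc k)))
                (cong -_ (sym (ℤP.pos-* (c₀ * c₀) (suc k))))
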